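{- Let $n,\lambda,k,r_1,\dots,r_k$ be positive integers such that $r_i n$ is even for every $i\in[k]$ and $\sum_{i=1}^k r_i=\lambda(n-1)$. Then $\lambda K_n^*$ is $(3r_1,\dots,3r_k)$-factorable.
   Context: $[k]=\{1,\dots,k\}$. A hypergraph is a pair $(V,E)$ with $V$ a finite set and $E$ a multiset of edges, each edge a multi-subset of $V$; write $\{u^2,v\}$ for the edge $\{u,u,v\}$. The degree of a vertex $v$ is the total number of occurrences of $v$ among all edges (counting multiplicities within edges). $K_n^*$ is the $3$-uniform hypergraph on $n$ vertices in which, for every ordered pair $(u,v)$ of distinct vertices, the edge $\{u^2,v\}$ has multiplicity $1$, and there are no other edges (edges $\{u,u,u\}$ and $\{u,v,w\}$ with $u,v,w$ distinct have multiplicity $0$). $\lambda\mathcal G$ is obtained from $\mathcal G$ by replacing each edge by $\lambda$ copies. An $r$-factor is a spanning sub-hypergraph in which every vertex has degree $r$; an $(s_1,\dots,s_k)$-factorization is a partition of the edge multiset into $F_1,\dots,F_k$ with $F_i$ an $s_i$-factor, and the hypergraph is $(s_1,\dots,s_k)$-factorable if one exists. -}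

module Defs where

open import Data.Nat using (ℕ; zero; suc; _+_; _*_)
open import Data.Fin using (Fin; _≟_)
open import Data.List using (List; []; _∷_; map; filter; concat; concatMap; replicate; allFin)
open import Data.Product using (_×_; _,_; proj₁; proj₂; Σ-syntax)
open import Relation.Binary.PropositionalEquality using (_≡_)
open import Relation.Nullary using (yes; no)

-- An edge on vertex set Fin n is a multi-subset of Fin n, represented as a
-- list of vertices (order irrelevant, repetitions = multiplicities).
Edge : ℕ → Set
Edge n = List (Fin n)

Hypergraph : ℕ → Set
Hypergraph n = List (Edge n)

occ : ∀ {n} → Fin n → Edge n → ℕ
occ v [] = 0
occ v (w ∷ e) with v ≟ w
... | yes _ = suc (occ v e)
... | no  _ = occ v e

deg : ∀ {n} → Fin n → Hypergraph n → ℕ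
deg v [] = 0
deg v (e ∷ H) = occ v e + deg v H

-- F is an r-factor (F is spanning since the vertex set is always Fin n)
IsFactor : ∀ {n} → ℕ → Hypergraph n → Set
IsFactor {n} r F = ∀ (v : Fin n) → deg v F ≡ r

Kstar : (n : ℕ) → Hypergraph n
Kstar n = concatMap (λ u → concatMap (λ v → pairEdge u v) (allFin n)) (allFin n)
  where
  pairEdge : Fin n → Fin n → Hypergraph n
  pairEdge u v with u ≟ v
  ... | yes _ = []
  ... | no  _ = (u ∷ u ∷ v ∷ []) ∷ []

_·H_ : ∀ {n} → ℕ → Hypergraph n → Hypergraph n
l ·H G = concatMap (replicate l) G

classOf : ∀ {n k} → Fin k → List (Edge n × Fin k) → Hypergraph n
classOf i L = map proj₁ (filter (λ p → proj₂ p ≟ i) L)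

-- An (s_1,...,s_k)-factorization of H: a partition of the edge multiset of H
-- into F_1..F_k (given as a labelling of each edge of H by a class in Fin k)
-- with F_i an s_i-factor.
Factorable : ∀ {n} (k : ℕ) → (Fin k → ℕ) → Hypergraph n → Set
Factorable {n} k s H =
  Σ[ L ∈ List (Edge n × Fin k) ] (map proj₁ L ≡ H × (∀ i → IsFactor (s i) (classOf i L)))

-- Colour the l copies of the edge {u², v} by a block of l colours selected by the cyclic
-- difference v − u mod n.  The list in which each colour i occurs r i times has length
-- l (n − 1) and is cut into n − 1 blocks, one for each nonzero difference; difference 0
-- (the absent loops) gets no colours.  A vertex w lies twice in each edge {w², v} and once
-- in each edge {u², w}, and as v (resp. u) runs over the other vertices the difference
-- v − w (resp. w − u) takes every nonzero value exactly once.  So w meets colour i exactly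
-- r i times in each role and has degree 2 r i + r i = 3 r i in class i.

module Submission where

open import Defs
open import Data.Nat using (ℕ; _*_; _∸_; _≥_)
open import Data.Nat.Divisibility using (_∣_)
open import Data.Fin using (Fin)
open import Data.List using (map; allFin)
open import Data.Nat.ListAction using (sum)
open import Relation.Binary.PropositionalEquality using (_≡_)

open import Data.Nat using (zero; suc; _+_; _≤_)
open import Data.Nat.Properties
  using (+-0-commutativeMonoid; +-identityʳ; +-assoc; +-comm; +-suc; *-comm; *-identityʳ; *-zeroʳ;
         *-distribˡ-+; +-cancelˡ-≡; <⇒≤; m≤m+n; m∸n≤m; m+[n∸m]≡n; m∸n+n≡m; m+n∸m≡n; +-∸-assoc; m≤n⇒m⊓n≡m)
open import Data.Nat.DivMod using (_%_; _mod_; %-distribˡ-+; m%n%n≡m%n; [m+n]%n≡m%n; m<n⇒m%n≡m; n%n≡0)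
open import Data.Fin using (zero; suc; toℕ; _≟_; opposite; punchIn)
open import Data.Fin.Properties using (toℕ-injective; toℕ-fromℕ<; toℕ<n; toℕ≤pred[n]; opposite-prop; punchInᵢ≢i)
open import Data.Fin.Permutation as Perm using (Permutation′; permutation; _⟨$⟩ˡ_)
open import Data.Vec.Functional as Vector using ()
open import Data.List
  using (List; []; _∷_; _++_; [_]; concat; concatMap; replicate; tabulate; filter; length; take; drop)
open import Data.List.Properties
  using (map-++; filter-++; length-++; length-replicate; length-take; length-drop; take++drop≡id;
         map-tabulate; map-concatMap; concatMap-cong)
open import Data.List.Effectful using (module MonadProperties)
open import Data.Product using (_×_; _,_; proj₁; proj₂; Σ-syntax)
open import Function using (_∘_; id)
open import Relation.Binary.PropositionalEquality using (_≢_; refl; sym; trans; cong; cong₂; subst; module ≡-Reasoning)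
open import Relation.Nullary using (yes; no)
open import Relation.Nullary.Negation using (contradiction)
open import Algebra.Properties.CommutativeMonoid.Sum +-0-commutativeMonoid
  using (sum-syntax; ∑-comm; ∑-distrib-+; ∑-permute; sum-remove; sum-cong-≗; sum-replicate-zero)

private
  variable
    A : Set
    n k : ℕ

∑-concentrated : ∀ (w : Fin n) (h : Fin n → ℕ) → (∀ u → u ≢ w → h u ≡ 0) → ∑[ u < n ] h u ≡ h w
∑-concentrated {suc n} w h off = begin
  ∑[ u < suc n ] h u                  ≡⟨ sum-remove h ⟩
  h w + ∑[ j < n ] h (punchIn w j)    ≡⟨ cong (h w +_) (sum-cong-≗ λ j → off _ (punchInᵢ≢i w j)) ⟩
  h w + ∑[ j < n ] 0                  ≡⟨ cong (h w +_) (sum-replicate-zero n) ⟩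
  h w + 0                             ≡⟨ +-identityʳ (h w) ⟩
  h w                                 ∎
  where open ≡-Reasoning

∑₂-distrib-+ : ∀ {m} (g h : Fin n → Fin m → ℕ) →
  ∑[ u < n ] ∑[ v < m ] (g u v + h u v) ≡ ∑[ u < n ] ∑[ v < m ] g u v + ∑[ u < n ] ∑[ v < m ] h u v
∑₂-distrib-+ {m = m} g h =
  trans (sum-cong-≗ (λ u → ∑-distrib-+ (g u) (h u))) (∑-distrib-+ (λ u → ∑[ v < m ] g u v) (λ u → ∑[ v < m ] h u v))

sum-map-tabulate : ∀ (f : A → ℕ) (g : Fin n → A) → sum (map f (tabulate g)) ≡ ∑[ i < n ] f (g i)
sum-map-tabulate {n = zero}  f g = refl
sum-map-tabulate {n = suc n} f g = cong (f (g zero) +_) (sum-map-tabulate f (g ∘ suc))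

module _ (φ : List A → ℕ) (φ-++ : ∀ xs ys → φ (xs ++ ys) ≡ φ xs + φ ys) where

  additive-[] : φ [] ≡ 0
  additive-[] = +-cancelˡ-≡ (φ []) _ _ (trans (sym (φ-++ [] [])) (sym (+-identityʳ (φ []))))

  additive-concat-tabulate : ∀ (f : Fin n → List A) → φ (concat (tabulate f)) ≡ ∑[ i < n ] φ (f i)
  additive-concat-tabulate {n = zero}  f = additive-[]
  additive-concat-tabulate {n = suc n} f =
    trans (φ-++ (f zero) _) (cong (φ (f zero) +_) (additive-concat-tabulate (f ∘ suc)))

  additive-concatMap-allFin : ∀ (f : Fin n → List A) → φ (concatMap f (allFin n)) ≡ ∑[ i < n ] φ (f i)
  additive-concatMap-allFin {n} f =
    trans (cong (φ ∘ concat) (map-tabulate id f)) (additive-concat-tabulate f)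

chunks : ∀ m l (xs : List A) → length xs ≡ m * l →
  Σ[ B ∈ (Fin m → List A) ] (∀ d → length (B d) ≡ l) × concat (tabulate B) ≡ xs
chunks zero    l []       _  = (λ ()) , (λ ()) , refl
chunks (suc m) l xs       eq with chunks m l (drop l xs) length-rest
  where
  length-rest : length (drop l xs) ≡ m * l
  length-rest = trans (length-drop l xs) (trans (cong (_∸ l) eq) (m+n∸m≡n l (m * l)))
... | B , length-B , concat-B =
  take l xs Vector.∷ B , length-take-∷ , trans (cong (take l xs ++_) concat-B) (take++drop≡id l xs)
  where
  length-take-∷ : ∀ d → length ((take l xs Vector.∷ B) d) ≡ l
  length-take-∷ zero    = trans (length-take l xs) (m≤n⇒m⊓n≡m (subst (l ≤_) (sym eq) (m≤m+n l (m * l))))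
  length-take-∷ (suc d) = length-B d

_⊕_ : Fin (suc n) → ℕ → Fin (suc n)
_⊕_ {n} x a = (toℕ x + a) mod suc n

toℕ-⊕ : ∀ (x : Fin (suc n)) a → toℕ (x ⊕ a) ≡ (toℕ x + a) % suc n
toℕ-⊕ x a = toℕ-fromℕ< _

⊕-⊕ : ∀ (x : Fin (suc n)) a b → (x ⊕ a) ⊕ b ≡ x ⊕ (a + b)
⊕-⊕ {n} x a b = toℕ-injective (begin
  toℕ ((x ⊕ a) ⊕ b)                    ≡⟨ toℕ-⊕ (x ⊕ a) b ⟩
  (toℕ (x ⊕ a) + b) % N                ≡⟨ cong (λ y → (y + b) % N) (toℕ-⊕ x a) ⟩
  ((toℕ x + a) % N + b) % N            ≡⟨ %-distribˡ-+ ((toℕ x + a) % N) b N ⟩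
  ((toℕ x + a) % N % N + b % N) % N    ≡⟨ cong (λ y → (y + b % N) % N) (m%n%n≡m%n (toℕ x + a) N) ⟩
  ((toℕ x + a) % N + b % N) % N        ≡⟨ %-distribˡ-+ (toℕ x + a) b N ⟨
  (toℕ x + a + b) % N                  ≡⟨ cong (_% N) (+-assoc (toℕ x) a b) ⟩
  (toℕ x + (a + b)) % N                ≡⟨ toℕ-⊕ x (a + b) ⟨
  toℕ (x ⊕ (a + b))                    ∎)
  where
  N : ℕ
  N = suc n
  open ≡-Reasoning

⊕-period : ∀ (x : Fin (suc n)) → x ⊕ suc n ≡ x
⊕-period {n} x = toℕ-injective (begin
  toℕ (x ⊕ suc n)        ≡⟨ toℕ-⊕ x (suc n) ⟩
  (toℕ x + suc n) % suc n ≡⟨ [m+n]%n≡m%n (toℕ x) (suc n) ⟩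
  toℕ x % suc n          ≡⟨ m<n⇒m%n≡m (toℕ<n x) ⟩
  toℕ x                  ∎)
  where open ≡-Reasoning

rotate : ∀ (a : ℕ) → a ≤ suc n → Permutation′ (suc n)
rotate {n} a a≤N = permutation (_⊕ a) (_⊕ (suc n ∸ a)) (cancel (m∸n+n≡m a≤N)) (cancel (m+[n∸m]≡n a≤N))
  where
  cancel : ∀ {b c} → b + c ≡ suc n → ∀ x → (x ⊕ b) ⊕ c ≡ x
  cancel {b} {c} b+c≡N x = trans (⊕-⊕ x b c) (trans (cong (x ⊕_) b+c≡N) (⊕-period x))

diff : Fin (suc n) → Fin (suc n) → Fin (suc n)
diff {n} u v = v ⊕ (suc n ∸ toℕ u)

diff-self : ∀ (u : Fin (suc n)) → diff u u ≡ zero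
diff-self {n} u = toℕ-injective (begin
  toℕ (diff u u)                     ≡⟨ toℕ-⊕ u (suc n ∸ toℕ u) ⟩
  (toℕ u + (suc n ∸ toℕ u)) % suc n  ≡⟨ cong (_% suc n) (m+[n∸m]≡n (<⇒≤ (toℕ<n u))) ⟩
  suc n % suc n                      ≡⟨ n%n≡0 (suc n) ⟩
  0                                  ∎)
  where open ≡-Reasoning

diffFrom : ∀ (u : Fin (suc n)) → Permutation′ (suc n)
diffFrom {n} u = rotate (suc n ∸ toℕ u) (m∸n≤m (suc n) (toℕ u))

diff≡zero⇒≡ : ∀ (u v : Fin (suc n)) → diff u v ≡ zero → v ≡ u
diff≡zero⇒≡ u v eq = begin
  v                                    ≡⟨ Perm.inverseˡ (diffFrom u) ⟨
  diffFrom u ⟨$⟩ˡ diff u v             ≡⟨ cong (diffFrom u ⟨$⟩ˡ_) (trans eq (sym (diff-self u))) ⟩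
  diffFrom u ⟨$⟩ˡ diff u u             ≡⟨ Perm.inverseˡ (diffFrom u) ⟩
  u                                    ∎
  where open ≡-Reasoning

diff-via-opposite : ∀ (u w : Fin (suc n)) → diff u w ≡ opposite u ⊕ suc (toℕ w)
diff-via-opposite {n} u w = toℕ-injective (begin
  toℕ (diff u w)                                ≡⟨ toℕ-⊕ w (suc n ∸ toℕ u) ⟩
  (toℕ w + (suc n ∸ toℕ u)) % suc n             ≡⟨ cong (_% suc n) shuffle ⟩
  (toℕ (opposite u) + suc (toℕ w)) % suc n      ≡⟨ toℕ-⊕ (opposite u) (suc (toℕ w)) ⟨
  toℕ (opposite u ⊕ suc (toℕ w))                ∎)
  where
  open ≡-Reasoning
  shuffle : toℕ w + (suc n ∸ toℕ u) ≡ toℕ (opposite u) + suc (toℕ w)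
  shuffle = begin
    toℕ w + (suc n ∸ toℕ u)            ≡⟨ cong (toℕ w +_) (+-∸-assoc 1 (toℕ≤pred[n] u)) ⟩
    toℕ w + suc (n ∸ toℕ u)            ≡⟨ +-suc (toℕ w) (n ∸ toℕ u) ⟩
    suc (toℕ w + (n ∸ toℕ u))          ≡⟨ cong suc (+-comm (toℕ w) (n ∸ toℕ u)) ⟩
    suc (n ∸ toℕ u + toℕ w)            ≡⟨ +-suc (n ∸ toℕ u) (toℕ w) ⟨
    n ∸ toℕ u + suc (toℕ w)            ≡⟨ cong (_+ suc (toℕ w)) (opposite-prop u) ⟨
    toℕ (opposite u) + suc (toℕ w)     ∎

∑-diff-row : ∀ (u : Fin (suc n)) (g : Fin (suc n) → ℕ) → ∑[ v < suc n ] g (diff u v) ≡ ∑[ d < suc n ] g d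
∑-diff-row u g = sym (∑-permute g (diffFrom u))

∑-diff-column : ∀ (w : Fin (suc n)) (g : Fin (suc n) → ℕ) → ∑[ u < suc n ] g (diff u w) ≡ ∑[ d < suc n ] g d
∑-diff-column {n} w g = begin
  ∑[ u < suc n ] g (diff u w)         ≡⟨ sum-cong-≗ (cong g ∘ λ u → diff-via-opposite u w) ⟩
  ∑[ u < suc n ] g (opposite u ⊕ a)   ≡⟨ ∑-permute (g ∘ (_⊕ a)) Perm.reverse ⟨
  ∑[ u < suc n ] g (u ⊕ a)            ≡⟨ ∑-permute g (rotate a (toℕ<n w)) ⟨
  ∑[ d < suc n ] g d                  ∎
  where
  a : ℕ
  a = suc (toℕ w)
  open ≡-Reasoning

occ-++ : ∀ (v : Fin n) e f → occ v (e ++ f) ≡ occ v e + occ v f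
occ-++ v []      f = refl
occ-++ v (w ∷ e) f with v ≟ w
... | yes _ = cong suc (occ-++ v e f)
... | no  _ = occ-++ v e f

occ-self : ∀ (v : Fin n) → occ v [ v ] ≡ 1
occ-self v with v ≟ v
... | yes _  = refl
... | no v≢v = contradiction refl v≢v

occ-≢ : ∀ {v w : Fin n} → v ≢ w → occ v [ w ] ≡ 0
occ-≢ {v = v} {w} v≢w with v ≟ w
... | yes v≡w = contradiction v≡w v≢w
... | no  _   = refl

occ-replicate : ∀ (v w : Fin n) c → occ v (replicate c w) ≡ c * occ v [ w ]
occ-replicate v w zero    = refl
occ-replicate v w (suc c) = trans (occ-++ v [ w ] (replicate c w)) (cong (occ v [ w ] +_) (occ-replicate v w c))

deg-++ : ∀ (v : Fin n) G H → deg v (G ++ H) ≡ deg v G + deg v H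
deg-++ v []      H = refl
deg-++ v (e ∷ G) H = trans (cong (occ v e +_) (deg-++ v G H)) (sym (+-assoc (occ v e) (deg v G) (deg v H)))

deg-·H : ∀ (v : Fin n) c H → deg v (c ·H H) ≡ c * deg v H
deg-·H v c []      = sym (*-zeroʳ c)
deg-·H v c (e ∷ H) = begin
  deg v (replicate c e ++ c ·H H)        ≡⟨ deg-++ v (replicate c e) (c ·H H) ⟩
  deg v (replicate c e) + deg v (c ·H H) ≡⟨ cong₂ _+_ (deg-replicate c) (deg-·H v c H) ⟩
  c * occ v e + c * deg v H              ≡⟨ *-distribˡ-+ c (occ v e) (deg v H) ⟨
  c * (occ v e + deg v H)                ∎
  where
  open ≡-Reasoning
  deg-replicate : ∀ c → deg v (replicate c e) ≡ c * occ v e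
  deg-replicate zero    = refl
  deg-replicate (suc c) = cong (occ v e +_) (deg-replicate c)

classOf-++ : ∀ (i : Fin k) (xs ys : List (Edge n × Fin k)) → classOf i (xs ++ ys) ≡ classOf i xs ++ classOf i ys
classOf-++ i xs ys =
  trans (cong (map proj₁) (filter-++ (λ p → proj₂ p ≟ i) xs ys)) (map-++ proj₁ (filter (λ p → proj₂ p ≟ i) xs) _)

-- A list of colours is an Edge k, so occ also counts colours.
palette : (Fin k → ℕ) → List (Fin k)
palette {k} r = concatMap (λ j → replicate (r j) j) (allFin k)

length-palette : ∀ (r : Fin k → ℕ) → length (palette r) ≡ sum (map r (allFin k))
length-palette {k} r = begin
  length (palette r)                    ≡⟨ additive-concatMap-allFin length (λ xs ys → length-++ xs) (λ j → replicate (r j) j) ⟩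
  ∑[ j < k ] length (replicate (r j) j) ≡⟨ sum-cong-≗ (λ j → length-replicate (r j)) ⟩
  ∑[ j < k ] r j                        ≡⟨ sum-map-tabulate r id ⟨
  sum (map r (allFin k))                ∎
  where open ≡-Reasoning

occ-palette : ∀ (r : Fin k → ℕ) i → occ i (palette r) ≡ r i
occ-palette {k} r i = begin
  occ i (palette r)                    ≡⟨ additive-concatMap-allFin (occ i) (occ-++ i) (λ j → replicate (r j) j) ⟩
  ∑[ j < k ] occ i (replicate (r j) j) ≡⟨ ∑-concentrated i _ others ⟩
  occ i (replicate (r i) i)            ≡⟨ occ-replicate i i (r i) ⟩
  r i * occ i [ i ]                    ≡⟨ cong (r i *_) (occ-self i) ⟩
  r i * 1                              ≡⟨ *-identityʳ (r i) ⟩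
  r i                                  ∎
  where
  open ≡-Reasoning
  others : ∀ j → j ≢ i → occ i (replicate (r j) j) ≡ 0
  others j j≢i = trans (occ-replicate i j (r j)) (trans (cong (r j *_) (occ-≢ (j≢i ∘ sym))) (*-zeroʳ (r j)))

colour-blocks : ∀ m l (r : Fin k → ℕ) → sum (map r (allFin k)) ≡ l * m →
  Σ[ B ∈ (Fin m → List (Fin k)) ] (∀ d → length (B d) ≡ l) × (∀ i → ∑[ d < m ] occ i (B d) ≡ r i)
colour-blocks m l r Σr≡lm with chunks m l (palette r) (trans (length-palette r) (trans Σr≡lm (*-comm l m)))
... | B , length-B , concat-B = B , length-B , count-B
  where
  count-B : ∀ i → ∑[ d < m ] occ i (B d) ≡ r i
  count-B i = trans (sym (additive-concat-tabulate (occ i) (occ-++ i) B)) (trans (cong (occ i) concat-B) (occ-palette r i))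

tag : List (Fin k) → Hypergraph n → List (Edge n × Fin k)
tag cs H = concatMap (λ e → map (e ,_) cs) H

map-proj₁-tag : ∀ (cs : List (Fin k)) (H : Hypergraph n) → map proj₁ (tag cs H) ≡ length cs ·H H
map-proj₁-tag cs H = trans (map-concatMap proj₁ _ H) (concatMap-cong (λ e → map-proj₁-copies e cs) H)
  where
  map-proj₁-copies : ∀ e (cs : List (Fin k)) → map proj₁ (map (e ,_) cs) ≡ replicate (length cs) e
  map-proj₁-copies e []       = refl
  map-proj₁-copies e (c ∷ cs) = cong (e ∷_) (map-proj₁-copies e cs)

classOf-tag : ∀ (i : Fin k) cs (H : Hypergraph n) → classOf i (tag cs H) ≡ occ i cs ·H H
classOf-tag i cs []      = refl
classOf-tag i cs (e ∷ H) = trans (classOf-++ i (map (e ,_) cs) (tag cs H)) (cong₂ _++_ (classOf-copies cs) (classOf-tag i cs H))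
  where
  classOf-copies : ∀ cs → classOf i (map (e ,_) cs) ≡ replicate (occ i cs) e
  classOf-copies []       = refl
  classOf-copies (c ∷ cs) with c ≟ i | i ≟ c
  ... | yes _   | yes _   = cong (e ∷_) (classOf-copies cs)
  ... | no  _   | no  _   = classOf-copies cs
  ... | yes c≡i | no  i≢c = contradiction (sym c≡i) i≢c
  ... | no  c≢i | yes i≡c = contradiction (sym i≡c) c≢i

-- The edge function local to Kstar is not in scope; unification recovers it from Kstar's body.
Kstar-unfolded : ∀ n → Σ[ pairEdges ∈ (Fin n → Fin n → Hypergraph n) ]
  Kstar n ≡ concatMap (λ u → concatMap (pairEdges u) (allFin n)) (allFin n)
Kstar-unfolded n = _ , refl

pairEdges : Fin n → Fin n → Hypergraph n
pairEdges {n} = proj₁ (Kstar-unfolded n)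

module _ {n k : ℕ} (c : Fin n → Fin n → List (Fin k)) where

  labelled : List (Edge n × Fin k)
  labelled = concatMap (λ u → concatMap (λ v → tag (c u v) (pairEdges u v)) (allFin n)) (allFin n)

  labelled-edges : ∀ l → (∀ u v → u ≢ v → length (c u v) ≡ l) → map proj₁ labelled ≡ l ·H Kstar n
  labelled-edges l length-c = begin
    map proj₁ labelled
      ≡⟨ map-concatMap proj₁ _ (allFin n) ⟩
    concatMap (λ u → map proj₁ (concatMap (λ v → tag (c u v) (pairEdges u v)) (allFin n))) (allFin n)
      ≡⟨ concatMap-cong (λ u → trans (map-concatMap proj₁ _ (allFin n)) (concatMap-cong (copies u) (allFin n))) (allFin n) ⟩
    concatMap (λ u → concatMap (λ v → l ·H pairEdges u v) (allFin n)) (allFin n)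
      ≡⟨ concatMap-cong (λ u → MonadProperties.associative (allFin n) (pairEdges u) (replicate l)) (allFin n) ⟩
    concatMap (λ u → l ·H concatMap (pairEdges u) (allFin n)) (allFin n)
      ≡⟨ MonadProperties.associative (allFin n) _ (replicate l) ⟩
    l ·H Kstar n
      ∎
    where
    open ≡-Reasoning
    -- Matching on u ≟ v is what makes pairEdges u v compute.
    copies : ∀ u v → map proj₁ (tag (c u v) (pairEdges u v)) ≡ l ·H pairEdges u v
    copies u v with u ≟ v
    ... | yes refl = refl
    ... | no  u≢v  = trans (map-proj₁-tag (c u v) [ u ∷ u ∷ v ∷ [] ]) (cong (_·H [ u ∷ u ∷ v ∷ [] ]) (length-c u v u≢v))

  degree-labelled : ∀ (i : Fin k) (w : Fin n) → (∀ u → occ i (c u u) ≡ 0) →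
    deg w (classOf i labelled) ≡ ∑[ u < n ] ∑[ v < n ] (occ i (c u v) * occ w (u ∷ u ∷ v ∷ []))
  degree-labelled i w diagonal = begin
    D labelled
      ≡⟨ additive-concatMap-allFin D D-++ (λ u → concatMap (λ v → tag (c u v) (pairEdges u v)) (allFin n)) ⟩
    ∑[ u < n ] D (concatMap (λ v → tag (c u v) (pairEdges u v)) (allFin n))
      ≡⟨ sum-cong-≗ (λ u → additive-concatMap-allFin D D-++ (λ v → tag (c u v) (pairEdges u v))) ⟩
    ∑[ u < n ] ∑[ v < n ] D (tag (c u v) (pairEdges u v))
      ≡⟨ sum-cong-≗ (λ u → sum-cong-≗ (λ v → tagged u v)) ⟩
    ∑[ u < n ] ∑[ v < n ] (occ i (c u v) * deg w (pairEdges u v))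
      ≡⟨ sum-cong-≗ (λ u → sum-cong-≗ (pair u)) ⟩
    ∑[ u < n ] ∑[ v < n ] (occ i (c u v) * occ w (u ∷ u ∷ v ∷ []))
      ∎
    where
    open ≡-Reasoning
    D : List (Edge n × Fin k) → ℕ
    D L = deg w (classOf i L)
    D-++ : ∀ xs ys → D (xs ++ ys) ≡ D xs + D ys
    D-++ xs ys = trans (cong (deg w) (classOf-++ i xs ys)) (deg-++ w (classOf i xs) (classOf i ys))
    tagged : ∀ u v → D (tag (c u v) (pairEdges u v)) ≡ occ i (c u v) * deg w (pairEdges u v)
    tagged u v = trans (cong (deg w) (classOf-tag i (c u v) (pairEdges u v))) (deg-·H w _ (pairEdges u v))
    pair : ∀ u v → occ i (c u v) * deg w (pairEdges u v) ≡ occ i (c u v) * occ w (u ∷ u ∷ v ∷ [])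
    pair u v with u ≟ v
    ... | yes refl = trans (*-zeroʳ (occ i (c u u))) (cong (_* occ w (u ∷ u ∷ u ∷ [])) (sym (diagonal u)))
    ... | no  _    = cong (occ i (c u v) *_) (+-identityʳ (occ w (u ∷ u ∷ v ∷ [])))

∑₂-select-row : ∀ (f : Fin n → Fin n → ℕ) w → ∑[ u < n ] ∑[ v < n ] (f u v * occ w [ u ]) ≡ ∑[ v < n ] f w v
∑₂-select-row {n} f w = begin
  ∑[ u < n ] ∑[ v < n ] (f u v * occ w [ u ])  ≡⟨ ∑-concentrated w _ off-row ⟩
  ∑[ v < n ] (f w v * occ w [ w ])             ≡⟨ sum-cong-≗ (λ v → trans (cong (f w v *_) (occ-self w)) (*-identityʳ (f w v))) ⟩
  ∑[ v < n ] f w v                             ∎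
  where
  open ≡-Reasoning
  off-row : ∀ u → u ≢ w → ∑[ v < n ] (f u v * occ w [ u ]) ≡ 0
  off-row u u≢w = trans (sum-cong-≗ (λ v → trans (cong (f u v *_) (occ-≢ (u≢w ∘ sym))) (*-zeroʳ (f u v)))) (sum-replicate-zero n)

∑₂-select-column : ∀ (f : Fin n → Fin n → ℕ) w → ∑[ u < n ] ∑[ v < n ] (f u v * occ w [ v ]) ≡ ∑[ u < n ] f u w
∑₂-select-column f w = trans (∑-comm (λ u v → f u v * occ w [ v ])) (∑₂-select-row (λ v u → f u v) w)

∑₂-occ-pairEdge : ∀ (f : Fin n → Fin n → ℕ) w →
  ∑[ u < n ] ∑[ v < n ] (f u v * occ w (u ∷ u ∷ v ∷ [])) ≡ ∑[ v < n ] f w v + (∑[ v < n ] f w v + ∑[ u < n ] f u w)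
∑₂-occ-pairEdge {n} f w = begin
  ∑[ u < n ] ∑[ v < n ] (f u v * occ w (u ∷ u ∷ v ∷ []))  ≡⟨ sum-cong-≗ (λ u → sum-cong-≗ (split u)) ⟩
  ∑[ u < n ] ∑[ v < n ] (R u v + (R u v + C u v))         ≡⟨ ∑₂-distrib-+ R (λ u v → R u v + C u v) ⟩
  ∑₂ R + ∑[ u < n ] ∑[ v < n ] (R u v + C u v)            ≡⟨ cong (∑₂ R +_) (∑₂-distrib-+ R C) ⟩
  ∑₂ R + (∑₂ R + ∑₂ C)                                    ≡⟨ cong₂ _+_ row (cong₂ _+_ row (∑₂-select-column f w)) ⟩
  ∑[ v < n ] f w v + (∑[ v < n ] f w v + ∑[ u < n ] f u w) ∎
  where
  open ≡-Reasoning
  R C : Fin n → Fin n → ℕ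
  R u v = f u v * occ w [ u ]
  C u v = f u v * occ w [ v ]
  ∑₂ : (Fin n → Fin n → ℕ) → ℕ
  ∑₂ g = ∑[ u < n ] ∑[ v < n ] g u v
  row : ∑₂ R ≡ ∑[ v < n ] f w v
  row = ∑₂-select-row f w
  split : ∀ u v → f u v * occ w (u ∷ u ∷ v ∷ []) ≡ R u v + (R u v + C u v)
  split u v = begin
    f u v * occ w ([ u ] ++ [ u ] ++ [ v ])                  ≡⟨ cong (f u v *_) (trans (occ-++ w [ u ] _) (cong (occ w [ u ] +_) (occ-++ w [ u ] [ v ]))) ⟩
    f u v * (occ w [ u ] + (occ w [ u ] + occ w [ v ]))      ≡⟨ *-distribˡ-+ (f u v) (occ w [ u ]) _ ⟩
    R u v + f u v * (occ w [ u ] + occ w [ v ])              ≡⟨ cong (R u v +_) (*-distribˡ-+ (f u v) (occ w [ u ]) (occ w [ v ])) ⟩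
    R u v + (R u v + C u v)                                  ∎

Factorable-cong : ∀ {s t : Fin k → ℕ} {H : Hypergraph n} → (∀ i → s i ≡ t i) → Factorable k s H → Factorable k t H
Factorable-cong s≡t (L , edges , factors) = L , edges , λ i w → trans (factors i w) (s≡t i)

cyclic-factorization : ∀ m l (B : Fin m → List (Fin k)) → (∀ d → length (B d) ≡ l) →
  Factorable k (λ i → 3 * ∑[ d < m ] occ i (B d)) (l ·H Kstar (suc m))
cyclic-factorization {k} m l B length-B = labelled c , labelled-edges c l length-c , degree
  where
  colours : Fin (suc m) → List (Fin k)
  colours = [] Vector.∷ B
  c : Fin (suc m) → Fin (suc m) → List (Fin k)
  c u v = colours (diff u v)
  length-c : ∀ u v → u ≢ v → length (c u v) ≡ l
  length-c u v u≢v with diff u v | diff≡zero⇒≡ u v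
  ... | zero  | diff≡zero⇒v≡u = contradiction (sym (diff≡zero⇒v≡u refl)) u≢v
  ... | suc d | _             = length-B d
  degree : ∀ i → IsFactor (3 * ∑[ d < m ] occ i (B d)) (classOf i (labelled c))
  degree i w = begin
    deg w (classOf i (labelled c))
      ≡⟨ degree-labelled c i w (λ u → cong (occ i ∘ colours) (diff-self u)) ⟩
    ∑[ u < suc m ] ∑[ v < suc m ] (occ i (c u v) * occ w (u ∷ u ∷ v ∷ []))
      ≡⟨ ∑₂-occ-pairEdge (λ u v → occ i (c u v)) w ⟩
    ∑[ v < suc m ] occ i (c w v) + (∑[ v < suc m ] occ i (c w v) + ∑[ u < suc m ] occ i (c u w))
      ≡⟨ cong₂ _+_ (∑-diff-row w count) (cong₂ _+_ (∑-diff-row w count) (∑-diff-column w count)) ⟩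
    total + (total + total)
      ≡⟨ cong (λ t → total + (total + t)) (+-identityʳ total) ⟨
    3 * total
      ∎
    where
    open ≡-Reasoning
    count : Fin (suc m) → ℕ
    count d = occ i (colours d)
    total : ℕ
    total = ∑[ d < m ] occ i (B d)

lemma2p2 : (n l k : ℕ) (r : Fin k → ℕ) →
    n ≥ 1 → l ≥ 1 → k ≥ 1 → (∀ i → r i ≥ 1) →
    (∀ i → 2 ∣ r i * n) →
    sum (map r (allFin k)) ≡ l * (n ∸ 1) →
    Factorable k (λ i → 3 * r i) (l ·H Kstar n)
lemma2p2 zero    l k r () _ _ _ _ _
lemma2p2 (suc m) l k r _ _ _ _ _ Σr≡lm =
  let (B , length-B , count-B) = colour-blocks m l r Σr≡lm in
  Factorable-cong (λ i → cong (3 *_) (count-B i)) (cyclic-factorization m l B length-B)
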